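{- Let $\ell$ be a prime and $\Gamma\subseteq\mathrm{Mp}_1(\mathbb{Z})$ a subgroup such that $\Gamma\cap\widetilde\Gamma_1(\ell)$ has index $\ell-1$ in $\Gamma\cap\widetilde\Gamma_0(\ell)$. Then $$\{0\}\times\big(\tfrac1\ell\mathbb{Z}\setminus\mathbb{Z}\big)\subseteq\mathbb{Z}^2+(0,\tfrac1\ell)\Gamma,$$ where $\Gamma$ acts on row vectors by right multiplication with the underlying matrices. This assumption is satisfied if $\Gamma$ is a congruence subgroup of level $N$ with $\gcd(\ell,N)=1$.
   Context: $\mathrm{Mp}_1(\mathbb{Z})$ is the metaplectic double cover of $\mathrm{SL}_2(\mathbb{Z})$ (pairs $(\gamma,\omega)$ with $\omega$ a holomorphic square root of $c\tau+d$); $\widetilde\Gamma_0(\ell)$, $\widetilde\Gamma_1(\ell)$, $\widetilde\Gamma(N)$ are the preimages of $\Gamma_0(\ell)$, $\Gamma_1(\ell)$, $\Gamma(N)$. A subgroup is a congruence subgroup of level $N$ if it contains $\widetilde\Gamma(N)$. -}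

module Defs where

open import Data.Nat as ℕ using (ℕ)
open import Data.Nat.Primality using (Prime; prime⇒nonZero)
open import Data.Integer as ℤ using (ℤ; +_; -[1+_]; 0ℤ; 1ℤ; _-_; -_)
open import Data.Integer.Divisibility using (_∣_)
open import Data.Integer.Tactic.RingSolver using (solve-∀)
open import Data.Sign as Sign using (Sign)
open import Data.Rational as ℚ using (ℚ; _/_)
open import Data.Fin using (Fin)
open import Data.Empty using (⊥)
open import Data.Product using (Σ; _×_; _,_)
open import Relation.Binary.PropositionalEquality using (_≡_; refl; cong₂; trans; sym)

record SL2 : Set where
  constructor mkSL2
  field
    a b c d : ℤ
    det : a ℤ.* d - b ℤ.* c ≡ 1ℤ
open SL2 public

private
  det-mul : ∀ a₁ b₁ c₁ d₁ a₂ b₂ c₂ d₂ →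
    (a₁ ℤ.* a₂ ℤ.+ b₁ ℤ.* c₂) ℤ.* (c₁ ℤ.* b₂ ℤ.+ d₁ ℤ.* d₂)
      - (a₁ ℤ.* b₂ ℤ.+ b₁ ℤ.* d₂) ℤ.* (c₁ ℤ.* a₂ ℤ.+ d₁ ℤ.* c₂)
    ≡ (a₁ ℤ.* d₁ - b₁ ℤ.* c₁) ℤ.* (a₂ ℤ.* d₂ - b₂ ℤ.* c₂)
  det-mul = solve-∀

  det-inv : ∀ a b c d → d ℤ.* a - (- b) ℤ.* (- c) ≡ a ℤ.* d - b ℤ.* c
  det-inv = solve-∀

_·SL_ : SL2 → SL2 → SL2
g ·SL h = mkSL2
  (a g ℤ.* a h ℤ.+ b g ℤ.* c h) (a g ℤ.* b h ℤ.+ b g ℤ.* d h)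
  (c g ℤ.* a h ℤ.+ d g ℤ.* c h) (c g ℤ.* b h ℤ.+ d g ℤ.* d h)
  (trans (det-mul (a g) (b g) (c g) (d g) (a h) (b h) (c h) (d h))
         (cong₂ ℤ._*_ (det g) (det h)))

invSL : SL2 → SL2
invSL g = mkSL2 (d g) (- b g) (- c g) (a g)
  (trans (det-inv (a g) (b g) (c g) (d g)) (det g))

I₂ : SL2
I₂ = mkSL2 1ℤ 0ℤ 0ℤ 1ℤ refl

-- An element (γ, ω) with ω a holomorphic square root of cτ+d on the upper
-- half plane is encoded as (γ , ε) where ω(τ) = ε · √(cτ+d), √ being the
-- principal branch (argument in (-π/2, π/2]).  Then
--   (γ₁,ω₁)(γ₂,ω₂) = (γ₁γ₂ , ω₁(γ₂τ) ω₂(τ))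
-- becomes (γ₁γ₂ , ε₁ ε₂ σ(γ₁,γ₂)) with the cocycle σ computed below.

record Mp : Set where
  constructor mp
  field
    mat  : SL2
    sgn  : Sign
open Mp public

-- Position of arg(cτ+d) ∈ (-π, π] (for τ in the upper half plane):
--   argZero : c = 0, d > 0  (arg = 0)
--   argPi   : c = 0, d < 0  (arg = π)
--   argUp   : c > 0         (arg ∈ (0, π))
--   argDown : c < 0         (arg ∈ (-π, 0))
data ArgClass : Set where
  argZero argPi argUp argDown : ArgClass

argClass : ℤ → ℤ → ArgClass
argClass (+ ℕ.suc _) _ = argUp
argClass -[1+ _ ] _ = argDown
argClass (+ 0) (+ ℕ.suc _) = argZero
argClass (+ 0) _ = argPi

-- σ(γ₁,γ₂) = √(c₁γ₂τ+d₁) √(c₂τ+d₂) / √(c₃τ+d₃)  ∈ {±1}, where γ₃ = γ₁γ₂.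
-- It is -1 exactly when arg(c₁γ₂τ+d₁) + arg(c₂τ+d₂) ∉ (-π, π].
-- Since γ₂τ lies in the upper half plane, the class of the first argument is
-- argClass c₁ d₁.  The parameter c₃ is the lower-left entry of γ₁γ₂.
cocycleCls : ArgClass → ArgClass → ℤ → Sign
cocycleCls argZero _ _ = Sign.+
cocycleCls _ argZero _ = Sign.+
cocycleCls argPi argPi _ = Sign.-
cocycleCls argPi argUp _ = Sign.-
cocycleCls argUp argPi _ = Sign.-
cocycleCls argPi argDown _ = Sign.+
cocycleCls argDown argPi _ = Sign.+
cocycleCls argUp argDown _ = Sign.+
cocycleCls argDown argUp _ = Sign.+
-- both arguments in (0,π): sum in (0,2π); wraps iff c₃ < 0
cocycleCls argUp argUp -[1+ _ ] = Sign.-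
cocycleCls argUp argUp (+ _) = Sign.+
-- both arguments in (-π,0): sum in (-2π,0); wraps iff c₃ ≥ 0
cocycleCls argDown argDown -[1+ _ ] = Sign.+
cocycleCls argDown argDown (+ _) = Sign.-

cocycle : SL2 → SL2 → Sign
cocycle g h = cocycleCls (argClass (c g) (d g)) (argClass (c h) (d h)) (c (g ·SL h))

_·_ : Mp → Mp → Mp
mp g ε · mp h δ = mp (g ·SL h) (ε Sign.* δ Sign.* cocycle g h)

1Mp : Mp
1Mp = mp I₂ Sign.+

-- inverse: (γ,ε)⁻¹ = (γ⁻¹, ε σ(γ,γ⁻¹)), so that (γ,ε)(γ,ε)⁻¹ = (I, 1)
_⁻¹ : Mp → Mp
(mp g ε) ⁻¹ = mp (invSL g) (ε Sign.* cocycle g (invSL g))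

record IsSubgroup (Γ : Mp → Set) : Set where
  field
    one : Γ 1Mp
    mul : ∀ {x y} → Γ x → Γ y → Γ (x · y)
    inv : ∀ {x} → Γ x → Γ (x ⁻¹)

_≡_mod_ : ℤ → ℤ → ℕ → Set
x ≡ y mod n = (+ n) ∣ (x - y)

Γ̃₀ : ℕ → Mp → Set
Γ̃₀ ℓ x = c (mat x) ≡ 0ℤ mod ℓ

Γ̃₁ : ℕ → Mp → Set
Γ̃₁ ℓ x = (a (mat x) ≡ 1ℤ mod ℓ) × (c (mat x) ≡ 0ℤ mod ℓ) × (d (mat x) ≡ 1ℤ mod ℓ)

Γ̃ : ℕ → Mp → Set
Γ̃ N x = (a (mat x) ≡ 1ℤ mod N) × (b (mat x) ≡ 0ℤ mod N)
      × (c (mat x) ≡ 0ℤ mod N) × (d (mat x) ≡ 1ℤ mod N)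

_∩_ : (Mp → Set) → (Mp → Set) → Mp → Set
(P ∩ Q) x = P x × Q x

_⊆_ : (Mp → Set) → (Mp → Set) → Set
P ⊆ Q = ∀ x → P x → Q x

IsCongruenceOfLevel : ℕ → (Mp → Set) → Set
IsCongruenceOfLevel N Γ = IsSubgroup Γ × (Γ̃ N ⊆ Γ)

-- H has index n in G  (H ⊆ G assumed by context): there are n elements
-- r₀,…,r_{n-1} of G such that every g ∈ G lies in exactly one coset rᵢH.
HasIndex : (H G : Mp → Set) → ℕ → Set
HasIndex H G n =
  Σ (Fin n → Mp) λ r →
    (∀ i → G (r i)) ×
    (∀ g → G g → Σ (Fin n) λ i → H ((r i ⁻¹) · g) × (∀ j → H ((r j ⁻¹) · g) → j ≡ i))

ℤ→ℚ : ℤ → ℚ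
ℤ→ℚ k = k / 1

_◃_ : ℚ × ℚ → Mp → ℚ × ℚ
(x , y) ◃ γ = ( x ℚ.* ℤ→ℚ (a (mat γ)) ℚ.+ y ℚ.* ℤ→ℚ (c (mat γ))
              , x ℚ.* ℤ→ℚ (b (mat γ)) ℚ.+ y ℚ.* ℤ→ℚ (d (mat γ)))

_+²_ : ℚ × ℚ → ℚ × ℚ → ℚ × ℚ
(x , y) +² (u , v) = (x ℚ.+ u , y ℚ.+ v)

_/ₚ_⟨_⟩ : ℤ → (ℓ : ℕ) → Prime ℓ → ℚ
k /ₚ ℓ ⟨ p ⟩ = _/_ k ℓ {{prime⇒nonZero p}}

In1/ℓℤMinusℤ : (ℓ : ℕ) → Prime ℓ → ℚ → Set
In1/ℓℤMinusℤ ℓ p x = (Σ ℤ λ k → x ≡ k /ₚ ℓ ⟨ p ⟩) × ((Σ ℤ λ m → x ≡ ℤ→ℚ m) → ⊥)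

InLattPlusOrbit : (ℓ : ℕ) → Prime ℓ → (Mp → Set) → ℚ × ℚ → Set
InLattPlusOrbit ℓ p Γ v =
  Σ ℤ λ m → Σ ℤ λ n → Σ Mp λ γ →
    Γ γ × (v ≡ (ℤ→ℚ m , ℤ→ℚ n) +² ((ℚ.0ℚ , 1ℤ /ₚ ℓ ⟨ p ⟩) ◃ γ))

{-# OPTIONS --safe #-}

-- On Γ ∩ Γ̃₀(ℓ) the lower-right entry d is a unit mod ℓ, and g, h lie in the same coset of
-- Γ ∩ Γ̃₁(ℓ) exactly when d(g) ≡ d(h) mod ℓ.  So ℓ - 1 coset representatives have pairwise
-- distinct, hence all, unit residues.  For x = k/ℓ ∉ ℤ the residue of k is a unit; if γ is the
-- representative with d(γ) ≡ k then (0, 1/ℓ)γ = (c/ℓ, d/ℓ) differs from (0, k/ℓ) by a vector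
-- in ℤ².  Conversely, if gcd(ℓ, N) = 1 each unit u mod ℓ is d(γ) for some γ ∈ Γ̃(N) ∩ Γ̃₀(ℓ),
-- a product of unipotent matrices, and these ℓ - 1 elements of Γ are coset representatives.

module Submission where

open import Defs
open import Data.Nat using (ℕ; _∸_)
open import Data.Nat.GCD using (gcd)
open import Data.Nat.Primality using (Prime)
open import Data.Rational using (ℚ; 0ℚ)
open import Data.Product using (_×_; _,_)
open import Relation.Binary.PropositionalEquality using (_≡_)

open import Data.Nat as ℕ using (zero; suc; NonZero; NonTrivial; s≤s)
import Data.Nat.Properties as ℕ
import Data.Nat.Divisibility as ℕ
open import Data.Nat.Coprimality as Coprime using (Coprime; coprime-Bézout; gcd≡1⇒coprime; prime⇒coprime)
open import Data.Nat.GCD using (module Bézout)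
open import Data.Nat.Primality using (prime⇒nonTrivial)
open import Data.Integer as ℤ using (ℤ; +_; 0ℤ; 1ℤ; _+_; _*_; _-_; -_)
import Data.Integer.Properties as ℤ
open import Data.Integer.Divisibility.Signed
  using (_∣_; divides; ∣⇒∣ᵤ; ∣ᵤ⇒∣; ∣m∣n⇒∣m+n; ∣m∣n⇒∣m-n; ∣m⇒∣m*n; ∣n⇒∣m*n; ∣m⇒∣-m; ∣-refl)
open import Data.Integer.DivMod using (_%ℕ_; _/ℕ_; n%ℕd<d; a≡a%ℕn+[a/ℕn]*n)
open import Data.Integer.Tactic.RingSolver using (solve)
import Data.Rational as ℚ
open import Data.Rational using (_/_; toℚᵘ)
import Data.Rational.Properties as ℚ
open import Data.Rational.Unnormalised as ℚᵘ using (mkℚᵘ; *≡*; _≃_)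
import Data.Rational.Unnormalised.Properties as ℚᵘ
open import Data.Fin as Fin using (Fin; toℕ; fromℕ<)
import Data.Fin.Properties as Fin
open import Data.Product using (Σ; ∃; proj₁; proj₂)
open import Data.List using (_∷_; [])
import Data.Sign as Sign
open import Function.Definitions using (Injective)
open import Relation.Nullary using (¬_; contradiction)
open import Level using (0ℓ)
open import Relation.Binary.Bundles using (Setoid)
import Relation.Binary.Reasoning.Setoid as SetoidReasoning
open import Relation.Binary.PropositionalEquality
  using (refl; sym; trans; cong; cong₂; subst; module ≡-Reasoning)

toℚᵘ-/ : ∀ i n .{{_ : NonZero n}} → toℚᵘ (i / n) ≃ i ℚᵘ./ n
toℚᵘ-/ i (suc n) = ℚ.toℚᵘ-fromℚᵘ (mkℚᵘ i n)

-- The denominators on the right come out as n ℕ.* 1 and n ℕ.+ 0.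
+-/ᵘ : ∀ m e n → (m * + suc n + e) ℚᵘ./ suc n ≃ m ℚᵘ./ 1 ℚᵘ.+ (1ℤ ℚᵘ./ suc n) ℚᵘ.* (e ℚᵘ./ 1)
+-/ᵘ m e n rewrite ℕ.*-identityʳ n | ℕ.+-identityʳ n = *≡* (cross m e (+ suc n))
  where
  cross : ∀ m e n → (m * n + e) * n ≡ (m * n + 1ℤ * e * 1ℤ) * n
  cross m e n = solve (m ∷ e ∷ n ∷ [])

+-/ : ∀ m e n .{{_ : NonZero n}} → (m * + n + e) / n ≡ ℤ→ℚ m ℚ.+ 1ℤ / n ℚ.* ℤ→ℚ e
+-/ m e (suc n) = ℚ.toℚᵘ-injective (begin
  toℚᵘ ((m * + suc n + e) / suc n)
    ≈⟨ toℚᵘ-/ _ (suc n) ⟩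
  (m * + suc n + e) ℚᵘ./ suc n
    ≈⟨ +-/ᵘ m e n ⟩
  m ℚᵘ./ 1 ℚᵘ.+ (1ℤ ℚᵘ./ suc n) ℚᵘ.* (e ℚᵘ./ 1)
    ≈⟨ ℚᵘ.+-cong (toℚᵘ-/ m 1) (ℚᵘ.*-cong (toℚᵘ-/ 1ℤ (suc n)) (toℚᵘ-/ e 1)) ⟨
  toℚᵘ (ℤ→ℚ m) ℚᵘ.+ toℚᵘ (1ℤ / suc n) ℚᵘ.* toℚᵘ (ℤ→ℚ e)
    ≈⟨ ℚᵘ.+-congʳ (toℚᵘ (ℤ→ℚ m)) (ℚ.toℚᵘ-homo-* (1ℤ / suc n) (ℤ→ℚ e)) ⟨
  toℚᵘ (ℤ→ℚ m) ℚᵘ.+ toℚᵘ (1ℤ / suc n ℚ.* ℤ→ℚ e)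
    ≈⟨ ℚ.toℚᵘ-homo-+ (ℤ→ℚ m) _ ⟨
  toℚᵘ (ℤ→ℚ m ℚ.+ 1ℤ / suc n ℚ.* ℤ→ℚ e)
    ∎)
  where open ℚᵘ.≃-Reasoning

∣⇒integral-/ : ∀ {n k} .{{_ : NonZero n}} → + n ∣ k → Σ ℤ λ q → k / n ≡ ℤ→ℚ q
∣⇒integral-/ {n} {k} (divides q k≡qn) = q , (begin
  k / n                             ≡⟨ cong (λ i → i / n) (trans k≡qn (sym (ℤ.+-identityʳ (q * + n)))) ⟩
  (q * + n + 0ℤ) / n                ≡⟨ +-/ q 0ℤ n ⟩
  ℤ→ℚ q ℚ.+ 1ℤ / n ℚ.* 0ℚ          ≡⟨ cong (ℤ→ℚ q ℚ.+_) (ℚ.*-zeroʳ (1ℤ / n)) ⟩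
  ℤ→ℚ q ℚ.+ 0ℚ                     ≡⟨ ℚ.+-identityʳ (ℤ→ℚ q) ⟩
  ℤ→ℚ q                             ∎)
  where open ≡-Reasoning

/-coordinate : ∀ {n} .{{_ : NonZero n}} k e w → + n ∣ e - k →
  Σ ℤ λ m → k / n ≡ ℤ→ℚ m ℚ.+ (0ℚ ℚ.* ℤ→ℚ w ℚ.+ 1ℤ / n ℚ.* ℤ→ℚ e)
/-coordinate {n} k e w (divides q e-k≡qn) = - q , (begin
  k / n                                              ≡⟨ cong (λ i → i / n) k≡-qn+e ⟩
  (- q * + n + e) / n                                ≡⟨ +-/ (- q) e n ⟩
  ℤ→ℚ (- q) ℚ.+ 1ℤ / n ℚ.* ℤ→ℚ e                    ≡⟨ cong (ℤ→ℚ (- q) ℚ.+_) (ℚ.+-identityˡ _) ⟨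
  ℤ→ℚ (- q) ℚ.+ (0ℚ ℚ.+ 1ℤ / n ℚ.* ℤ→ℚ e)           ≡⟨ cong (λ z → ℤ→ℚ (- q) ℚ.+ (z ℚ.+ 1ℤ / n ℚ.* ℤ→ℚ e))
                                                               (ℚ.*-zeroˡ (ℤ→ℚ w)) ⟨
  ℤ→ℚ (- q) ℚ.+ (0ℚ ℚ.* ℤ→ℚ w ℚ.+ 1ℤ / n ℚ.* ℤ→ℚ e) ∎)
  where
  open ≡-Reasoning
  k≡-qn+e : k ≡ - q * + n + e
  k≡-qn+e = begin
    k                    ≡⟨ solve (k ∷ e ∷ []) ⟩
    - (e - k) + e        ≡⟨ cong (λ z → - z + e) e-k≡qn ⟩
    - (q * + n) + e      ≡⟨ cong (_+ e) (ℤ.neg-distribˡ-* q (+ n)) ⟩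
    - q * + n + e        ∎

lattice-translate : ∀ {n} .{{_ : NonZero n}} (γ : Mp) k → + n ∣ c (mat γ) → + n ∣ d (mat γ) - k →
  Σ ℤ λ m₁ → Σ ℤ λ m₂ → (0ℚ , k / n) ≡ (ℤ→ℚ m₁ , ℤ→ℚ m₂) +² ((0ℚ , 1ℤ / n) ◃ γ)
lattice-translate {n} γ k n∣c n∣d-k =
  let (m₁ , 0/n≡) = /-coordinate 0ℤ (c (mat γ)) (a (mat γ)) n∣c-0
      (m₂ , k/n≡) = /-coordinate k (d (mat γ)) (b (mat γ)) n∣d-k
  in m₁ , m₂ , cong₂ _,_ (trans (sym (ℚ.0/n≡0 n)) 0/n≡) k/n≡
  where
  n∣c-0 : + n ∣ c (mat γ) - 0ℤ
  n∣c-0 = subst (+ n ∣_) (sym (ℤ.+-identityʳ (c (mat γ)))) n∣c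

1+z-1≡z : ∀ z → 1ℤ + z - 1ℤ ≡ z
1+z-1≡z z = solve (z ∷ [])

≡-mod-refl : ∀ {ℓ} x → x ≡ x mod ℓ
≡-mod-refl {ℓ} x = ∣⇒∣ᵤ {+ ℓ} (divides 0ℤ (ℤ.+-inverseʳ x))

-- Agda cannot infer x and y from x ≡ y mod ℓ, which unfolds to ℓ ∣ ∣ x - y ∣, so chains of
-- congruences go through setoid reasoning, where every endpoint is written out.
≡-mod-setoid : ℕ → Setoid 0ℓ 0ℓ
≡-mod-setoid ℓ = record
  { Carrier       = ℤ
  ; _≈_           = λ x y → x ≡ y mod ℓ
  ; isEquivalence = record
    { refl  = λ {x} → ≡-mod-refl x
    ; sym   = λ {x} {y} → subst (ℓ ℕ.∣_) (ℤ.∣i-j∣≡∣j-i∣ x y)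
    ; trans = λ {x} {y} {z} x≡y y≡z → ∣⇒∣ᵤ (subst (+ ℓ ∣_) (ℤ.+-minus-telescope x y z)
                                        (∣m∣n⇒∣m+n (∣ᵤ⇒∣ {i = x - y} x≡y) (∣ᵤ⇒∣ {i = y - z} y≡z)))
    }
  }

module ≡-mod-Reasoning (ℓ : ℕ) = SetoidReasoning (≡-mod-setoid ℓ)

module _ {ℓ : ℕ} where

  ≡0-mod⇒∣ : ∀ {x} → x ≡ 0ℤ mod ℓ → + ℓ ∣ x
  ≡0-mod⇒∣ {x} x≡0 = subst (+ ℓ ∣_) (ℤ.+-identityʳ x) (∣ᵤ⇒∣ x≡0)

  ∣⇒≡0-mod : ∀ {x} → + ℓ ∣ x → x ≡ 0ℤ mod ℓ
  ∣⇒≡0-mod {x} ℓ∣x = ∣⇒∣ᵤ (subst (+ ℓ ∣_) (sym (ℤ.+-identityʳ x)) ℓ∣x)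

  ∣⇒1+≡1-mod : ∀ {x} → + ℓ ∣ x → (1ℤ + x) ≡ 1ℤ mod ℓ
  ∣⇒1+≡1-mod {x} ℓ∣x = ∣⇒∣ᵤ (subst (+ ℓ ∣_) (sym (1+z-1≡z x)) ℓ∣x)

inverse-mod : ∀ {n ℓ} → Coprime n ℓ → ∃ λ v → + ℓ ∣ + n * v - 1ℤ
inverse-mod {n} {ℓ} n⊥ℓ = fromBézout (coprime-Bézout n⊥ℓ)
  where
  open ≡-Reasoning
  inℤ : ∀ a b c e → 1 ℕ.+ a ℕ.* b ≡ c ℕ.* e → 1ℤ + + a * + b ≡ + c * + e
  inℤ a b c e eq = begin
    1ℤ + + a * + b         ≡⟨ cong (λ z → 1ℤ + z) (ℤ.pos-* a b) ⟨
    1ℤ + + (a ℕ.* b)       ≡⟨ ℤ.pos-+ 1 (a ℕ.* b) ⟨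
    + (1 ℕ.+ a ℕ.* b)      ≡⟨ cong +_ eq ⟩
    + (c ℕ.* e)            ≡⟨ ℤ.pos-* c e ⟩
    + c * + e              ∎
  n[-x]-1≡-[1+xn] : ∀ n x → n * - x - 1ℤ ≡ - (1ℤ + x * n)
  n[-x]-1≡-[1+xn] n x = solve (n ∷ x ∷ [])
  fromBézout : Bézout.Identity 1 n ℓ → ∃ λ v → + ℓ ∣ + n * v - 1ℤ
  fromBézout (Bézout.+- x y 1+yℓ≡xn) = + x , divides (+ y) (begin
    + n * + x - 1ℤ         ≡⟨ cong (_- 1ℤ) (ℤ.*-comm (+ n) (+ x)) ⟩
    + x * + n - 1ℤ         ≡⟨ cong (_- 1ℤ) (inℤ y ℓ x n 1+yℓ≡xn) ⟨
    1ℤ + + y * + ℓ - 1ℤ    ≡⟨ 1+z-1≡z (+ y * + ℓ) ⟩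
    + y * + ℓ              ∎)
  fromBézout (Bézout.-+ x y 1+xn≡yℓ) = - + x , divides (- + y) (begin
    + n * - + x - 1ℤ       ≡⟨ n[-x]-1≡-[1+xn] (+ n) (+ x) ⟩
    - (1ℤ + + x * + n)     ≡⟨ cong -_ (inℤ x n y ℓ 1+xn≡yℓ) ⟩
    - (+ y * + ℓ)          ≡⟨ ℤ.neg-distribˡ-* (+ y) (+ ℓ) ⟩
    - + y * + ℓ            ∎)

module _ {ℓ : ℕ} where

  d≡⇒⁻¹·∈Γ̃₁ : ∀ g h → Γ̃₀ ℓ g → Γ̃₀ ℓ h → d (mat g) ≡ d (mat h) mod ℓ → Γ̃₁ ℓ ((g ⁻¹) · h)
  d≡⇒⁻¹·∈Γ̃₁ (mp (mkSL2 a₁ b₁ c₁ d₁ det₁) _) (mp (mkSL2 a₂ b₂ c₂ d₂ det₂) _) c₁≡0 c₂≡0 d₁≡d₂ =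
    ∣⇒∣ᵤ (subst (+ ℓ ∣_) a-entry (∣m∣n⇒∣m+n (∣n⇒∣m*n a₂ ℓ∣d₁-d₂) (∣n⇒∣m*n (b₂ - b₁) ℓ∣c₂))) ,
    ∣⇒≡0-mod (∣m∣n⇒∣m+n (∣m⇒∣m*n a₂ (∣m⇒∣-m ℓ∣c₁)) (∣n⇒∣m*n a₁ ℓ∣c₂)) ,
    ∣⇒∣ᵤ (subst (+ ℓ ∣_) d-entry (∣m∣n⇒∣m+n (∣n⇒∣m*n (- a₁) ℓ∣d₁-d₂) (∣n⇒∣m*n (b₁ - b₂) ℓ∣c₁)))
    where
    open ≡-Reasoning
    ℓ∣c₁ : + ℓ ∣ c₁
    ℓ∣c₁ = ≡0-mod⇒∣ c₁≡0
    ℓ∣c₂ : + ℓ ∣ c₂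
    ℓ∣c₂ = ≡0-mod⇒∣ c₂≡0
    ℓ∣d₁-d₂ : + ℓ ∣ d₁ - d₂
    ℓ∣d₁-d₂ = ∣ᵤ⇒∣ d₁≡d₂
    a-entry : a₂ * (d₁ - d₂) + (b₂ - b₁) * c₂ ≡ d₁ * a₂ + - b₁ * c₂ - 1ℤ
    a-entry = begin
      a₂ * (d₁ - d₂) + (b₂ - b₁) * c₂            ≡⟨ solve (a₂ ∷ b₁ ∷ b₂ ∷ c₂ ∷ d₁ ∷ d₂ ∷ []) ⟩
      d₁ * a₂ + - b₁ * c₂ - (a₂ * d₂ - b₂ * c₂)  ≡⟨ cong (λ one → d₁ * a₂ + - b₁ * c₂ - one) det₂ ⟩
      d₁ * a₂ + - b₁ * c₂ - 1ℤ                   ∎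
    d-entry : - a₁ * (d₁ - d₂) + (b₁ - b₂) * c₁ ≡ - c₁ * b₂ + a₁ * d₂ - 1ℤ
    d-entry = begin
      - a₁ * (d₁ - d₂) + (b₁ - b₂) * c₁          ≡⟨ solve (a₁ ∷ b₁ ∷ b₂ ∷ c₁ ∷ d₁ ∷ d₂ ∷ []) ⟩
      - c₁ * b₂ + a₁ * d₂ - (a₁ * d₁ - b₁ * c₁)  ≡⟨ cong (λ one → - c₁ * b₂ + a₁ * d₂ - one) det₁ ⟩
      - c₁ * b₂ + a₁ * d₂ - 1ℤ                   ∎

  ⁻¹·∈Γ̃₁⇒d≡ : ∀ g h → Γ̃₀ ℓ g → Γ̃₁ ℓ ((g ⁻¹) · h) → d (mat h) ≡ d (mat g) mod ℓ
  ⁻¹·∈Γ̃₁⇒d≡ (mp (mkSL2 a₁ b₁ c₁ d₁ det₁) _) (mp (mkSL2 _ b₂ _ d₂ _) _) c₁≡0 (_ , _ , d≡1) =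
    ∣⇒∣ᵤ (subst (+ ℓ ∣_) d-difference
      (∣m∣n⇒∣m+n (∣n⇒∣m*n d₁ ℓ∣d-1) (∣m⇒∣m*n (d₁ * b₂ - b₁ * d₂) ℓ∣c₁)))
    where
    open ≡-Reasoning
    ℓ∣c₁ : + ℓ ∣ c₁
    ℓ∣c₁ = ≡0-mod⇒∣ c₁≡0
    ℓ∣d-1 : + ℓ ∣ - c₁ * b₂ + a₁ * d₂ - 1ℤ
    ℓ∣d-1 = ∣ᵤ⇒∣ d≡1
    d-difference : d₁ * (- c₁ * b₂ + a₁ * d₂ - 1ℤ) + c₁ * (d₁ * b₂ - b₁ * d₂) ≡ d₂ - d₁
    d-difference = begin
      d₁ * (- c₁ * b₂ + a₁ * d₂ - 1ℤ) + c₁ * (d₁ * b₂ - b₁ * d₂)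
        ≡⟨ cong (λ one → d₁ * (- c₁ * b₂ + a₁ * d₂ - one) + c₁ * (d₁ * b₂ - b₁ * d₂)) det₁ ⟨
      d₁ * (- c₁ * b₂ + a₁ * d₂ - (a₁ * d₁ - b₁ * c₁)) + c₁ * (d₁ * b₂ - b₁ * d₂)
        ≡⟨ solve (a₁ ∷ b₁ ∷ c₁ ∷ d₁ ∷ b₂ ∷ d₂ ∷ []) ⟩
      (d₂ - d₁) * (a₁ * d₁ - b₁ * c₁)  ≡⟨ cong ((d₂ - d₁) *_) det₁ ⟩
      (d₂ - d₁) * 1ℤ                   ≡⟨ ℤ.*-identityʳ (d₂ - d₁) ⟩
      d₂ - d₁                          ∎

  Γ̃₀⇒d≢0 : .{{NonTrivial ℓ}} → ∀ g → Γ̃₀ ℓ g → ¬ (d (mat g) ≡ 0ℤ mod ℓ)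
  Γ̃₀⇒d≢0 (mp (mkSL2 a₁ b₁ c₁ d₁ det₁) _) c≡0 d≡0 =
    ℕ.<⇒≢ (ℕ.nonTrivial⇒n>1 ℓ) (sym (ℕ.∣1⇒≡1 (∣⇒∣ᵤ ℓ∣1)))
    where
    ℓ∣c₁ : + ℓ ∣ c₁
    ℓ∣c₁ = ≡0-mod⇒∣ c≡0
    ℓ∣d₁ : + ℓ ∣ d₁
    ℓ∣d₁ = ≡0-mod⇒∣ d≡0
    ℓ∣1 : + ℓ ∣ 1ℤ
    ℓ∣1 = subst (+ ℓ ∣_) det₁ (∣m∣n⇒∣m-n (∣n⇒∣m*n a₁ ℓ∣d₁) (∣n⇒∣m*n b₁ ℓ∣c₁))

  d≡⇒⁻¹·∈Γ∩Γ̃₁ : ∀ {Γ} → IsSubgroup Γ → ∀ {g h} → (Γ ∩ Γ̃₀ ℓ) g → (Γ ∩ Γ̃₀ ℓ) h →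
    d (mat g) ≡ d (mat h) mod ℓ → (Γ ∩ Γ̃₁ ℓ) ((g ⁻¹) · h)
  d≡⇒⁻¹·∈Γ∩Γ̃₁ Γ-sub {g} {h} (g∈Γ , g∈Γ̃₀) (h∈Γ , h∈Γ̃₀) d≡d =
    IsSubgroup.mul Γ-sub (IsSubgroup.inv Γ-sub g∈Γ) h∈Γ , d≡⇒⁻¹·∈Γ̃₁ g h g∈Γ̃₀ h∈Γ̃₀ d≡d

∣∧<⇒≡0 : ∀ {ℓ k} → ℓ ℕ.∣ k → k ℕ.< ℓ → k ≡ 0
∣∧<⇒≡0 {k = zero}  _   _   = refl
∣∧<⇒≡0 {k = suc _} ℓ∣k k<ℓ = contradiction ℓ∣k (ℕ.>⇒∤ k<ℓ)

≡-mod-<⇒≡ : ∀ {ℓ a b} → a ℕ.< ℓ → b ℕ.< ℓ → (+ a) ≡ (+ b) mod ℓ → a ≡ b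
≡-mod-<⇒≡ {ℓ} {a} {b} a<ℓ b<ℓ ℓ∣a-b =
  ℤ.+-injective (ℤ.i-j≡0⇒i≡j (+ a) (+ b) (ℤ.∣i∣≡0⇒i≡0 (∣∧<⇒≡0 ℓ∣a-b ∣a-b∣<ℓ)))
  where
  open ℕ.≤-Reasoning
  ∣a-b∣<ℓ : ℤ.∣ + a - + b ∣ ℕ.< ℓ
  ∣a-b∣<ℓ = begin-strict
    ℤ.∣ + a - + b ∣   ≡⟨ cong ℤ.∣_∣ (ℤ.m-n≡m⊖n a b) ⟩
    ℤ.∣ a ℤ.⊖ b ∣     ≤⟨ ℤ.∣m⊝n∣≤m⊔n a b ⟩
    a ℕ.⊔ b           <⟨ ℕ.⊔-lub a<ℓ b<ℓ ⟩
    ℓ                 ∎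

≡-mod-%ℕ : ∀ x ℓ .{{_ : NonZero ℓ}} → x ≡ (+ (x %ℕ ℓ)) mod ℓ
≡-mod-%ℕ x ℓ = ∣⇒∣ᵤ (divides (x /ℕ ℓ) x-r≡qℓ)
  where
  cancel : ∀ r s → r + s - r ≡ s
  cancel r s = solve (r ∷ s ∷ [])
  x-r≡qℓ : x - + (x %ℕ ℓ) ≡ (x /ℕ ℓ) * + ℓ
  x-r≡qℓ = trans (cong (_- + (x %ℕ ℓ)) (a≡a%ℕn+[a/ℕn]*n x ℓ)) (cancel (+ (x %ℕ ℓ)) ((x /ℕ ℓ) * + ℓ))

module _ {m : ℕ} where

  nonzeroResidue : Fin m → ℤ
  nonzeroResidue i = + suc (toℕ i)

  nonzeroResidue-injective : ∀ {i j} → nonzeroResidue i ≡ nonzeroResidue j mod suc m → i ≡ j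
  nonzeroResidue-injective {i} {j} i≡j = Fin.toℕ-injective (ℕ.suc-injective
    (≡-mod-<⇒≡ (s≤s (Fin.toℕ<n i)) (s≤s (Fin.toℕ<n j)) i≡j))

  ≡-mod-nonzeroResidue : ∀ x → ¬ (x ≡ 0ℤ mod suc m) → ∃ λ i → x ≡ nonzeroResidue i mod suc m
  ≡-mod-nonzeroResidue x x≢0 with x %ℕ suc m | n%ℕd<d x (suc m) | ≡-mod-%ℕ x (suc m)
  ... | zero  | _       | x≡0 = contradiction x≡0 x≢0
  ... | suc r | s≤s r<m | x≡r =
    fromℕ< r<m , subst (λ k → x ≡ (+ suc k) mod suc m) (sym (Fin.toℕ-fromℕ< r<m)) x≡r

injective⇒surjective : ∀ {n} {f : Fin n → Fin n} → Injective _≡_ _≡_ f → ∀ y → ∃ λ x → f x ≡ y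
injective⇒surjective {n} {f} f-injective y with Fin.pigeonhole (ℕ.n<1+n n) y∷f
  where
  y∷f : Fin (suc n) → Fin n
  y∷f Fin.zero    = y
  y∷f (Fin.suc x) = f x
... | Fin.zero  , Fin.suc x , _   , y≡fx  = x , sym y≡fx
... | Fin.suc i , Fin.suc j , i<j , fi≡fj = contradiction (f-injective fi≡fj) (Fin.<⇒≢ (ℕ.s<s⁻¹ i<j))

-- The product [[1,0],[y,1]] [[1,x],[0,1]] [[1,0],[z,1]].
lowerUpperLower : ℤ → ℤ → ℤ → SL2
lowerUpperLower x y z = mkSL2 (1ℤ + x * z) x (y + z * (1ℤ + x * y)) (1ℤ + x * y) det≡1
  where
  det≡1 : (1ℤ + x * z) * (1ℤ + x * y) - x * (y + z * (1ℤ + x * y)) ≡ 1ℤ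
  det≡1 = solve (x ∷ y ∷ z ∷ [])

lowerUpperLower-∈Γ̃ : ∀ {N x y z} s → + N ∣ x → + N ∣ y → + N ∣ z → Γ̃ N (mp (lowerUpperLower x y z) s)
lowerUpperLower-∈Γ̃ {x = x} {y} {z} _ N∣x N∣y N∣z =
  ∣⇒1+≡1-mod (∣m⇒∣m*n z N∣x) ,
  ∣⇒≡0-mod N∣x ,
  ∣⇒≡0-mod (∣m∣n⇒∣m+n N∣y (∣m⇒∣m*n (1ℤ + x * y) N∣z)) ,
  ∣⇒1+≡1-mod (∣m⇒∣m*n y N∣x)

-- With N t ≡ 1 and u v ≡ 1 (mod ℓ), this has d = 1 + N² (u - 1) t² ≡ u and c = N (1 - v d) ≡ 0.
unitLift : ℤ → ℤ → ℤ → ℤ → SL2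
unitLift N t u v = lowerUpperLower (N * ((u - 1ℤ) * t * t)) N (- (N * v))

unitLift-d≡ : ∀ {ℓ} N t u v → + ℓ ∣ N * t - 1ℤ → d (unitLift N t u v) ≡ u mod ℓ
unitLift-d≡ {ℓ} N t u v ℓ∣Nt-1 =
  ∣⇒∣ᵤ (subst (+ ℓ ∣_) d-u (∣n⇒∣m*n (u - 1ℤ) (∣m⇒∣m*n (N * t + 1ℤ) ℓ∣Nt-1)))
  where
  d-u : (u - 1ℤ) * ((N * t - 1ℤ) * (N * t + 1ℤ)) ≡ 1ℤ + N * ((u - 1ℤ) * t * t) * N - u
  d-u = solve (N ∷ t ∷ u ∷ [])

unitLift-c≡0 : ∀ {ℓ} N t u v → + ℓ ∣ N * t - 1ℤ → + ℓ ∣ u * v - 1ℤ → c (unitLift N t u v) ≡ 0ℤ mod ℓ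
unitLift-c≡0 {ℓ} N t u v ℓ∣Nt-1 ℓ∣uv-1 =
  ∣⇒≡0-mod (subst (+ ℓ ∣_) c≡ (∣m∣n⇒∣m+n (∣n⇒∣m*n (- N) ℓ∣uv-1) (∣n⇒∣m*n (- (N * v)) ℓ∣d-u)))
  where
  ℓ∣d-u : + ℓ ∣ d (unitLift N t u v) - u
  ℓ∣d-u = ∣ᵤ⇒∣ (unitLift-d≡ N t u v ℓ∣Nt-1)
  c≡ : - N * (u * v - 1ℤ) + - (N * v) * (1ℤ + N * ((u - 1ℤ) * t * t) * N - u)
     ≡ N + - (N * v) * (1ℤ + N * ((u - 1ℤ) * t * t) * N)
  c≡ = solve (N ∷ t ∷ u ∷ v ∷ [])

Γ̃-element-with-d≡ : ∀ {ℓ N n} → Coprime N ℓ → Coprime n ℓ →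
  Σ Mp λ γ → Γ̃ N γ × Γ̃₀ ℓ γ × d (mat γ) ≡ (+ n) mod ℓ
Γ̃-element-with-d≡ {ℓ} {N} {n} N⊥ℓ n⊥ℓ =
  let (t , ℓ∣Nt-1) = inverse-mod N⊥ℓ
      (v , ℓ∣nv-1) = inverse-mod n⊥ℓ
  in mp (unitLift (+ N) t (+ n) v) Sign.+
   , lowerUpperLower-∈Γ̃ Sign.+ (∣m⇒∣m*n _ ∣-refl) ∣-refl (∣m⇒∣-m (∣m⇒∣m*n v ∣-refl))
   , unitLift-c≡0 (+ N) t (+ n) v ℓ∣Nt-1 ℓ∣nv-1
   , unitLift-d≡ (+ N) t (+ n) v ℓ∣Nt-1

module _ {m : ℕ} .{{_ : NonTrivial (suc m)}} {Γ : Mp → Set} (Γ-sub : IsSubgroup Γ) where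

  private
    ℓ : ℕ
    ℓ = suc m

  hasIndex⇒d-surjective : HasIndex (Γ ∩ Γ̃₁ ℓ) (Γ ∩ Γ̃₀ ℓ) m →
    ∀ k → ¬ (k ≡ 0ℤ mod ℓ) → Σ Mp λ γ → (Γ ∩ Γ̃₀ ℓ) γ × d (mat γ) ≡ k mod ℓ
  hasIndex⇒d-surjective (r , r∈ , cover) k k≢0 =
    let (y , k≡y)  = ≡-mod-nonzeroResidue k k≢0
        (j , fj≡y) = injective⇒surjective {f = f} f-injective y
    in r j , r∈ j , (begin
         d (mat (r j))          ≈⟨ d≡f j ⟩
         nonzeroResidue (f j)   ≡⟨ cong nonzeroResidue fj≡y ⟩
         nonzeroResidue y       ≈⟨ k≡y ⟨
         k                      ∎)
    where
    open ≡-mod-Reasoning ℓ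
    d≢0 : ∀ i → ¬ (d (mat (r i)) ≡ 0ℤ mod ℓ)
    d≢0 i = Γ̃₀⇒d≢0 (r i) (proj₂ (r∈ i))
    f : Fin m → Fin m
    f i = proj₁ (≡-mod-nonzeroResidue (d (mat (r i))) (d≢0 i))
    d≡f : ∀ i → d (mat (r i)) ≡ nonzeroResidue (f i) mod ℓ
    d≡f i = proj₂ (≡-mod-nonzeroResidue (d (mat (r i))) (d≢0 i))
    same-coset : ∀ {i j} → d (mat (r i)) ≡ d (mat (r j)) mod ℓ → i ≡ j
    same-coset {i} {j} di≡dj =
      trans (unique i (d≡⇒⁻¹·∈Γ∩Γ̃₁ Γ-sub (r∈ i) (r∈ j) di≡dj))
            (sym (unique j (d≡⇒⁻¹·∈Γ∩Γ̃₁ Γ-sub (r∈ j) (r∈ j) (≡-mod-refl (d (mat (r j)))))))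
      where
      unique = proj₂ (proj₂ (cover (r j) (r∈ j)))
    f-injective : Injective _≡_ _≡_ f
    f-injective {i} {j} fi≡fj = same-coset (begin
      d (mat (r i))          ≈⟨ d≡f i ⟩
      nonzeroResidue (f i)   ≡⟨ cong nonzeroResidue fi≡fj ⟩
      nonzeroResidue (f j)   ≈⟨ d≡f j ⟨
      d (mat (r j))          ∎)

  hasIndex⇒orbit : (p : Prime ℓ) → HasIndex (Γ ∩ Γ̃₁ ℓ) (Γ ∩ Γ̃₀ ℓ) m →
    ∀ x → In1/ℓℤMinusℤ ℓ p x → InLattPlusOrbit ℓ p Γ (0ℚ , x)
  hasIndex⇒orbit p index x ((k , refl) , x∉ℤ) =
    let (γ , (γ∈Γ , c≡0) , dγ≡k) = hasIndex⇒d-surjective index k k≢0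
        (m₁ , m₂ , translate)    = lattice-translate γ k (≡0-mod⇒∣ c≡0) (∣ᵤ⇒∣ dγ≡k)
    in m₁ , m₂ , γ , γ∈Γ , translate
    where
    k≢0 : ¬ (k ≡ 0ℤ mod ℓ)
    k≢0 k≡0 = x∉ℤ (∣⇒integral-/ ℓ∣k)
      where
      ℓ∣k : + ℓ ∣ k
      ℓ∣k = ≡0-mod⇒∣ k≡0

  residueReps⇒hasIndex : (∀ i → Σ Mp λ γ → (Γ ∩ Γ̃₀ ℓ) γ × d (mat γ) ≡ nonzeroResidue i mod ℓ) →
    HasIndex (Γ ∩ Γ̃₁ ℓ) (Γ ∩ Γ̃₀ ℓ) m
  residueReps⇒hasIndex rep = r , r∈ , cover
    where
    open ≡-mod-Reasoning ℓ
    r : Fin m → Mp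
    r i = proj₁ (rep i)
    r∈ : ∀ i → (Γ ∩ Γ̃₀ ℓ) (r i)
    r∈ i = proj₁ (proj₂ (rep i))
    d≡i : ∀ i → d (mat (r i)) ≡ nonzeroResidue i mod ℓ
    d≡i i = proj₂ (proj₂ (rep i))
    cover : ∀ g → (Γ ∩ Γ̃₀ ℓ) g → Σ (Fin m) λ i →
      (Γ ∩ Γ̃₁ ℓ) ((r i ⁻¹) · g) × (∀ j → (Γ ∩ Γ̃₁ ℓ) ((r j ⁻¹) · g) → j ≡ i)
    cover g g∈@(_ , c≡0) =
      let (i , dg≡i) = ≡-mod-nonzeroResidue (d (mat g)) (Γ̃₀⇒d≢0 g c≡0)
      in i
       , d≡⇒⁻¹·∈Γ∩Γ̃₁ Γ-sub (r∈ i) g∈ (begin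
           d (mat (r i))      ≈⟨ d≡i i ⟩
           nonzeroResidue i   ≈⟨ dg≡i ⟨
           d (mat g)          ∎)
       , λ j (_ , rj⁻¹g∈Γ̃₁) → nonzeroResidue-injective (begin
           nonzeroResidue j   ≈⟨ d≡i j ⟨
           d (mat (r j))      ≈⟨ ⁻¹·∈Γ̃₁⇒d≡ (r j) g (proj₂ (r∈ j)) rj⁻¹g∈Γ̃₁ ⟨
           d (mat g)          ≈⟨ dg≡i ⟩
           nonzeroResidue i   ∎)

  congruence⇒hasIndex : Prime ℓ → ∀ N → IsCongruenceOfLevel N Γ → gcd ℓ N ≡ 1 →
    HasIndex (Γ ∩ Γ̃₁ ℓ) (Γ ∩ Γ̃₀ ℓ) m
  congruence⇒hasIndex p N (_ , Γ̃N⊆Γ) gcd≡1 = residueReps⇒hasIndex rep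
    where
    rep : ∀ i → Σ Mp λ γ → (Γ ∩ Γ̃₀ ℓ) γ × d (mat γ) ≡ nonzeroResidue i mod ℓ
    rep i =
      let (γ , γ∈Γ̃ , γ∈Γ̃₀ , d≡i) = Γ̃-element-with-d≡ (Coprime.sym (gcd≡1⇒coprime gcd≡1))
                                      (Coprime.sym (prime⇒coprime p (s≤s (Fin.toℕ<n i))))
      in γ , (Γ̃N⊆Γ γ γ∈Γ̃ , γ∈Γ̃₀) , d≡i

lemma3p4 : (ℓ : ℕ) (p : Prime ℓ) (Γ : Mp → Set) → IsSubgroup Γ →
  (HasIndex (Γ ∩ Γ̃₁ ℓ) (Γ ∩ Γ̃₀ ℓ) (ℓ ∸ 1) →
    ∀ (x : ℚ) → In1/ℓℤMinusℤ ℓ p x → InLattPlusOrbit ℓ p Γ (0ℚ , x))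
  × (∀ (N : ℕ) → IsCongruenceOfLevel N Γ → gcd ℓ N ≡ 1 →
    HasIndex (Γ ∩ Γ̃₁ ℓ) (Γ ∩ Γ̃₀ ℓ) (ℓ ∸ 1))
lemma3p4 zero    ()
lemma3p4 (suc m) p Γ Γ-sub = hasIndex⇒orbit Γ-sub p , congruence⇒hasIndex Γ-sub p
  where
  instance
    _ = prime⇒nonTrivial p
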